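{- Let $b\ge2$ be an integer. For all integers $n,k$, \[\binom{n}{k}_b=\binom{n}{n-k}_b.\]
   Context: Fix an integer base $b\ge2$. Every integer $m\ge0$ has base-$b$ digits $m_l\in\{0,\dots,b-1\}$ with $m=\sum_{l\ge0}m_lb^l$. By convention, for $m>0$ the digits of $-m$ are $-m_l$. For $m\in\mathbb Z$ with digits $m_l$, put $f_{m,b}(x)=\prod_{l\ge0}(1+x^{b^l})^{m_l}$. The $b$-ary binomial coefficient $\binom{m}{k}_b$ ($m,k\in\mathbb Z$) is defined as: if $m\ge0$, the coefficient of $x^k$ in the polynomial $f_{m,b}(x)$ (zero for $k<0$); if $m<0$ and $k\ge0$, the coefficient of $x^k$ in the power series expansion of $f_{m,b}(x)$ about $x=0$; if $m<0$ and $k<0$, the coefficient of $x^k$ in the expansion of $f_{m,b}(x)$ as a power series in $1/x$. -}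

module Defs where

open import Data.Bool using (if_then_else_)
open import Data.Nat as ℕ using (ℕ; zero; suc; NonZero)
open import Data.Nat.DivMod using (_/_; _%_)
open import Data.Integer as ℤ using (ℤ; +_; -[1+_]; 0ℤ; 1ℤ)
open import Relation.Nullary.Decidable using (⌊_⌋)

Series : Set
Series = ℕ → ℤ

sumTo : (ℕ → ℤ) → ℕ → ℤ
sumTo g zero    = g zero
sumTo g (suc n) = g (suc n) ℤ.+ sumTo g n

_⊛_ : Series → Series → Series
(f ⊛ g) n = sumTo (λ i → f i ℤ.* g (n ℕ.∸ i)) n

oneS : Series
oneS zero    = 1ℤ
oneS (suc _) = 0ℤ

spow : Series → ℕ → Series
spow f zero    = oneS
spow f (suc n) = f ⊛ spow f n

prodTo : (ℕ → Series) → ℕ → Series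
prodTo F zero    = F zero
prodTo F (suc N) = F (suc N) ⊛ prodTo F N

ind : ℕ → ℕ → ℤ
ind n c = if ⌊ n ℕ.≟ c ⌋ then 1ℤ else 0ℤ

negOnePow : ℕ → ℤ
negOnePow zero    = 1ℤ
negOnePow (suc j) = ℤ.- negOnePow j

digit : (b : ℕ) → .{{NonZero b}} → ℕ → ℕ → ℕ
digit b zero    m = m % b
digit b (suc l) m = digit b l (m / b)

onePlusX : ℕ → Series
onePlusX c n = ind n 0 ℤ.+ ind n c

-- (1 + x^c)^{-1} expanded as a power series in x (c ≥ 1):
-- Σ_{j≥0} (-1)^j x^{cj}
invOnePlusX : ℕ → Series
invOnePlusX c n = sumTo (λ j → ind (c ℕ.* j) n ℤ.* negOnePow j) n

-- (1 + x^c)^{-1} expanded as a power series in y = 1/x (c ≥ 1):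
-- x^{-c} (1 + x^{-c})^{-1} = Σ_{j≥0} (-1)^j y^{c(j+1)}
invOnePlusXinY : ℕ → Series
invOnePlusXinY c i = sumTo (λ j → ind (c ℕ.* suc j) i ℤ.* negOnePow j) i

-- For m ≥ 0: f_{m,b}(x) = ∏_l (1 + x^{b^l})^{m_l}.
-- The product is taken over l = 0..m; all digits m_l with l > m vanish
-- (b^l > m), so the omitted factors are 1.
fPos : (b : ℕ) → .{{NonZero b}} → ℕ → Series
fPos b m = prodTo (λ l → spow (onePlusX (b ℕ.^ l)) (digit b l m)) m

-- For m' > 0: f_{-m',b}(x) = ∏_l (1 + x^{b^l})^{-m'_l}, as a power series in x.
fNegX : (b : ℕ) → .{{NonZero b}} → ℕ → Series
fNegX b m' = prodTo (λ l → spow (invOnePlusX (b ℕ.^ l)) (digit b l m')) m'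

-- For m' > 0: f_{-m',b}(x) expanded as a power series in y = 1/x.
fNegY : (b : ℕ) → .{{NonZero b}} → ℕ → Series
fNegY b m' = prodTo (λ l → spow (invOnePlusXinY (b ℕ.^ l)) (digit b l m')) m'

binomB : (b : ℕ) → .{{NonZero b}} → ℤ → ℤ → ℤ
binomB b (+ m)      (+ k)      = fPos b m k
binomB b (+ m)      -[1+ k ]   = 0ℤ
binomB b -[1+ m' ]  (+ k)      = fNegX b (suc m') k
-- coefficient of x^{-(k+1)} = coefficient of y^{k+1}
binomB b -[1+ m' ]  -[1+ k ]   = fNegY b (suc m') (suc k)

module Submission where

-- For n = m ≥ 0, f_{m,b} = ∏_l (1 + x^{b^l})^{m_l} is a palindrome of degree
-- Σ_l m_l b^l = m: extending coefficients by zero to all of ℤ, c_{m-k} = c_k.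
-- Each factor 1 + x^c is a palindrome of degree c, and palindromes of degrees
-- p and q multiply to one of degree p + q (reverse the Cauchy sum).
--
-- For n = -M < 0, the expansion Y of f_{-M,b} in y = 1/x is y^M times its
-- expansion X in x, since (1 + x^c)^{-1} = y^c (1 + y^c)^{-1} and shifts add
-- under multiplication.  The reflection k ↦ -M - k exchanges coefficients of
-- X with those of Y beyond y^M, and pairs up coefficients of Y below y^M,
-- which vanish.

open import Defs
open import Data.Nat using (ℕ; NonZero; _≤_)
open import Data.Integer using (ℤ; _-_)
open import Relation.Binary.PropositionalEquality using (_≡_)
open import Data.Nat as ℕ using (zero; suc; _<_; z≤n; s≤s; _∸_; _+_; _*_; _^_)
import Data.Nat.Properties as ℕP
open import Data.Nat.DivMod using (_/_; _%_; m≡m%n+[m/n]*n)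
open import Data.Integer as ℤ using (+_; -[1+_]; 0ℤ; _⊖_)
import Data.Integer.Properties as ℤP
import Data.Nat.Tactic.RingSolver as ℕSolver
import Data.Integer.Tactic.RingSolver as ℤSolver
open import Data.Product using (_,_; _×_; proj₁; proj₂)
open import Data.Sum using (inj₁; inj₂)
open import Data.Empty using (⊥-elim)
open import Relation.Nullary using (yes; no; ¬_)
open import Relation.Binary.PropositionalEquality
  using (refl; sym; trans; cong; cong₂; subst; subst₂; module ≡-Reasoning)

sumTo-cong : ∀ {h h'} n → (∀ i → i ≤ n → h i ≡ h' i) → sumTo h n ≡ sumTo h' n
sumTo-cong zero    e = e 0 z≤n
sumTo-cong (suc n) e =
  cong₂ ℤ._+_ (e (suc n) ℕP.≤-refl) (sumTo-cong n (λ i i≤n → e i (ℕP.m≤n⇒m≤1+n i≤n)))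

sumTo-zero : ∀ {h} n → (∀ i → i ≤ n → h i ≡ 0ℤ) → sumTo h n ≡ 0ℤ
sumTo-zero n e = trans (sumTo-cong n e) (zeros n)
  where
    zeros : ∀ n → sumTo (λ _ → 0ℤ) n ≡ 0ℤ
    zeros zero    = refl
    zeros (suc n) = trans (ℤP.+-identityˡ _) (zeros n)

sumTo-pad : ∀ {h} n N → n ≤ N → (∀ i → n < i → i ≤ N → h i ≡ 0ℤ) →
            sumTo h N ≡ sumTo h n
sumTo-pad _ zero z≤n _ = refl
sumTo-pad {h} n (suc N) n≤1+N zeros with ℕP.m≤n⇒m<n∨m≡n n≤1+N
... | inj₂ refl      = refl
... | inj₁ (s≤s n≤N) =
  trans (cong₂ ℤ._+_ (zeros (suc N) (s≤s n≤N) ℕP.≤-refl)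
                     (sumTo-pad n N n≤N (λ i n<i i≤N → zeros i n<i (ℕP.m≤n⇒m≤1+n i≤N))))
        (ℤP.+-identityˡ (sumTo h n))

sumTo-rev : ∀ h n → sumTo h n ≡ sumTo (λ i → h (n ∸ i)) n
sumTo-rev h zero    = refl
sumTo-rev h (suc n) = begin
    sumTo h (suc n)
  ≡⟨ peel h n ⟩
    sumTo (λ i → h (suc i)) n ℤ.+ h 0
  ≡⟨ cong (ℤ._+ h 0) (sumTo-rev (λ i → h (suc i)) n) ⟩
    sumTo (λ i → h (suc (n ∸ i))) n ℤ.+ h 0
  ≡⟨ cong (ℤ._+ h 0) (sumTo-cong n (λ i i≤n → cong h (sym (ℕP.+-∸-assoc 1 i≤n)))) ⟩
    sumTo (λ i → h (suc n ∸ i)) n ℤ.+ h 0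
  ≡⟨ ℤP.+-comm _ (h 0) ⟩
    h 0 ℤ.+ sumTo (λ i → h (suc n ∸ i)) n
  ≡⟨ cong (λ z → h z ℤ.+ sumTo (λ i → h (suc n ∸ i)) n) (sym (ℕP.n∸n≡0 n)) ⟩
    h (suc n ∸ suc n) ℤ.+ sumTo (λ i → h (suc n ∸ i)) n
  ∎
  where
    open ≡-Reasoning
    peel : ∀ h n → sumTo h (suc n) ≡ sumTo (λ i → h (suc i)) n ℤ.+ h 0
    peel h zero    = refl
    peel h (suc n) =
      trans (cong (ℤ._+_ (h (suc (suc n)))) (peel h n)) (sym (ℤP.+-assoc (h (suc (suc n))) _ _))

sumTo-dropZeros : ∀ {h} s M → (∀ i → i < s → h i ≡ 0ℤ) →
                  sumTo h (s + M) ≡ sumTo (λ j → h (s + j)) M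
sumTo-dropZeros zero M e = refl
sumTo-dropZeros {h} (suc s) zero e = begin
    sumTo h (suc s + 0)
  ≡⟨ cong (sumTo h) (ℕP.+-identityʳ (suc s)) ⟩
    h (suc s) ℤ.+ sumTo h s
  ≡⟨ cong (ℤ._+_ (h (suc s))) (sumTo-zero s (λ i i≤s → e i (s≤s i≤s))) ⟩
    h (suc s) ℤ.+ 0ℤ
  ≡⟨ ℤP.+-identityʳ _ ⟩
    h (suc s)
  ≡⟨ cong h (sym (ℕP.+-identityʳ (suc s))) ⟩
    h (suc s + 0)
  ∎
  where open ≡-Reasoning
sumTo-dropZeros {h} (suc s) (suc M) e =
  cong (ℤ._+_ (h (suc s + suc M)))
       (trans (cong (sumTo h) (ℕP.+-suc s M)) (sumTo-dropZeros (suc s) M e))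

natSum : (ℕ → ℕ) → ℕ → ℕ
natSum a zero    = a zero
natSum a (suc N) = a (suc N) + natSum a N

ext : Series → ℤ → ℤ
ext f (+ n)    = f n
ext f -[1+ _ ] = 0ℤ

ext-negative : ∀ f {j} → j ℤ.< 0ℤ → ext f j ≡ 0ℤ
ext-negative f { -[1+ _ ]} _       = refl
ext-negative f {+ _}      (ℤ.+<+ ())

pos-sub : ∀ {p i} → i ≤ p → + p - + i ≡ + (p ∸ i)
pos-sub {p} {i} i≤p = trans (ℤP.m-n≡m⊖n p i) (ℤP.⊖-≥ i≤p)

pos-sub-negative : ∀ {p i} → p < i → + p - + i ℤ.< 0ℤ
pos-sub-negative {p} {i} p<i =
  subst₂ ℤ._<_ (sym (ℤP.m-n≡m⊖n p i)) (ℤP.n⊖n≡0 p) (ℤP.⊖-monoʳ->-< p p<i)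

conv-ext : ∀ f g p → (∀ i → p < i → f i ≡ 0ℤ) →
           ∀ j → ext (f ⊛ g) j ≡ sumTo (λ i → f i ℤ.* ext g (j - + i)) p
conv-ext f g p fz (+ n) = begin
    sumTo (λ i → f i ℤ.* g (n ∸ i)) n
  ≡⟨ sumTo-cong n (λ i i≤n → cong (λ z → f i ℤ.* ext g z) (sym (pos-sub i≤n))) ⟩
    sumTo term n
  ≡⟨ sym (sumTo-pad n (n + p) (ℕP.m≤m+n n p) (λ i n<i _ →
       trans (cong (f i ℤ.*_) (ext-negative g (pos-sub-negative n<i))) (ℤP.*-zeroʳ (f i)))) ⟩
    sumTo term (n + p)
  ≡⟨ sumTo-pad p (n + p) (ℕP.m≤n+m p n) (λ i p<i _ →
       trans (cong (ℤ._* ext g (+ n - + i)) (fz i p<i)) (ℤP.*-zeroˡ (ext g (+ n - + i)))) ⟩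
    sumTo term p
  ∎
  where
    open ≡-Reasoning
    term : ℕ → ℤ
    term i = f i ℤ.* ext g (+ n - + i)
conv-ext f g p fz -[1+ n ] = sym (sumTo-zero p (λ i _ →
  trans (cong (f i ℤ.*_) (ext-negative g (ℤP.≤-<-trans (ℤP.i-j≤i -[1+ n ] (+ i)) ℤ.-<+)))
        (ℤP.*-zeroʳ (f i))))

-- Palindromic polynomials

-- f is a palindrome of degree p:  f_{p-j} = f_j for all integers j,
-- i.e. f(x) = x^p f(1/x); in particular f vanishes beyond degree p.
Pal : Series → ℕ → Set
Pal f p = ∀ j → ext f (+ p - j) ≡ ext f j

pal-vanish : ∀ {f p} → Pal f p → ∀ i → p < i → f i ≡ 0ℤ
pal-vanish {f} pf i p<i = trans (sym (pf (+ i))) (ext-negative f (pos-sub-negative p<i))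

pal-mirror : ∀ {f p} → Pal f p → ∀ {i} → i ≤ p → f (p ∸ i) ≡ f i
pal-mirror {f} pf {i} i≤p = trans (cong (ext f) (sym (pos-sub i≤p))) (pf (+ i))

pal-intro : ∀ {f} p → (∀ i → p < i → f i ≡ 0ℤ) → (∀ i → i ≤ p → f i ≡ f (p ∸ i)) →
            Pal f p
pal-intro {f} p deg mirror (+ i) with ℕP.≤-<-connex i p
... | inj₁ i≤p = trans (cong (ext f) (pos-sub i≤p)) (sym (mirror i i≤p))
... | inj₂ p<i = trans (ext-negative f (pos-sub-negative p<i)) (sym (deg i p<i))
pal-intro p deg mirror -[1+ k ] = deg (p + suc k) (ℕP.m<m+n p (s≤s z≤n))

-- Palindromes of degrees p and q multiply to a palindrome of degree p + q:
-- reversing the sum Σ_{i≤p} f_i g_{j-i} turns (fg)_{p+q-j} into (fg)_j.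
pal-⊛ : ∀ {f g p q} → Pal f p → Pal g q → Pal (f ⊛ g) (p + q)
pal-⊛ {f} {g} {p} {q} pf pg j = begin
    ext (f ⊛ g) (+ (p + q) - j)
  ≡⟨ conv-ext f g p (pal-vanish pf) (+ (p + q) - j) ⟩
    sumTo (λ i → f i ℤ.* ext g (+ (p + q) - j - + i)) p
  ≡⟨ sumTo-rev _ p ⟩
    sumTo (λ i → f (p ∸ i) ℤ.* ext g (+ (p + q) - j - + (p ∸ i))) p
  ≡⟨ sumTo-cong p (λ i i≤p → cong₂ ℤ._*_ (pal-mirror pf i≤p) (mirrored-factor i≤p)) ⟩
    sumTo (λ i → f i ℤ.* ext g (j - + i)) p
  ≡⟨ sym (conv-ext f g p (pal-vanish pf) j) ⟩
    ext (f ⊛ g) j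
  ∎
  where
    open ≡-Reasoning
    reflect : ∀ P Q J I → P ℤ.+ Q - J - (P - I) ≡ Q - (J - I)
    reflect = ℤSolver.solve-∀
    mirrored-factor : ∀ {i} → i ≤ p → ext g (+ (p + q) - j - + (p ∸ i)) ≡ ext g (j - + i)
    mirrored-factor {i} i≤p = begin
        ext g (+ (p + q) - j - + (p ∸ i))
      ≡⟨ cong (λ z → ext g (+ (p + q) - j - z)) (sym (pos-sub i≤p)) ⟩
        ext g (+ p ℤ.+ + q - j - (+ p - + i))
      ≡⟨ cong (ext g) (reflect (+ p) (+ q) j (+ i)) ⟩
        ext g (+ q - (j - + i))
      ≡⟨ pg (j - + i) ⟩
        ext g (j - + i)
      ∎

pal-oneS : Pal oneS 0
pal-oneS = pal-intro 0 (λ { (suc i) _ → refl }) (λ { zero _ → refl })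

pal-spow : ∀ {f c} → Pal f c → ∀ d → Pal (spow f d) (d * c)
pal-spow pf zero    = pal-oneS
pal-spow pf (suc d) = pal-⊛ pf (pal-spow pf d)

pal-prod : ∀ {F a} → (∀ l → Pal (F l) (a l)) → ∀ N → Pal (prodTo F N) (natSum a N)
pal-prod h zero    = h zero
pal-prod h (suc N) = pal-⊛ (h (suc N)) (pal-prod h N)

ind-iff : ∀ x y x' y' → (x ≡ y → x' ≡ y') → (x' ≡ y' → x ≡ y) → ind x y ≡ ind x' y'
ind-iff x y x' y' to from with x ℕ.≟ y | x' ℕ.≟ y'
... | yes _ | yes _ = refl
... | no _  | no _  = refl
... | yes p | no q  = ⊥-elim (q (to p))
... | no p  | yes q = ⊥-elim (p (from q))

ind-no : ∀ x y → ¬ x ≡ y → ind x y ≡ 0ℤ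
ind-no x y x≢y with x ℕ.≟ y
... | yes p = ⊥-elim (x≢y p)
... | no _  = refl

pal-onePlusX : ∀ c → Pal (onePlusX c) c
pal-onePlusX c = pal-intro c deg mirror
  where
    deg : ∀ i → c < i → onePlusX c i ≡ 0ℤ
    deg i c<i = cong₂ ℤ._+_ (ind-no i 0 (λ { refl → ℕP.<⇒≱ c<i z≤n }))
                            (ind-no i c (λ { refl → ℕP.<-irrefl refl c<i }))
    mirror : ∀ i → i ≤ c → onePlusX c i ≡ onePlusX c (c ∸ i)
    mirror i i≤c = trans (cong₂ ℤ._+_ low high) (ℤP.+-comm (ind (c ∸ i) c) (ind (c ∸ i) 0))
      where
        low : ind i 0 ≡ ind (c ∸ i) c
        low = ind-iff _ _ _ _ (λ { refl → refl })
                (λ e → ℕP.+-cancelˡ-≡ c i 0 (trans (trans (cong (_+ i) (sym e))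
                         (ℕP.m∸n+n≡m i≤c)) (sym (ℕP.+-identityʳ c))))
        high : ind i c ≡ ind (c ∸ i) 0
        high = ind-iff _ _ _ _ (λ { refl → ℕP.n∸n≡0 i })
                 (λ e → ℕP.≤-antisym i≤c (ℕP.m∸n≡0⇒m≤n e))

-- Shifted series

-- f' = x^s f:  f' vanishes below s and f'_{s+i} = f_i.
Shift : Series → Series → ℕ → Set
Shift f' f s = (∀ i → i < s → f' i ≡ 0ℤ) × (∀ i → f' (s + i) ≡ f i)

shift-⊛ : ∀ {f' f g' g s t} → Shift f' f s → Shift g' g t → Shift (f' ⊛ g') (f ⊛ g) (s + t)
shift-⊛ {f'} {f} {g'} {g} {s} {t} (fz , fe) (gz , ge) = low , shifted
  where
    open ≡-Reasoning
    -- in f'_i g'_{n-i} with n < s + t, either i < s or n - i < t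
    low : ∀ n → n < s + t → (f' ⊛ g') n ≡ 0ℤ
    low n n<s+t = sumTo-zero n term
      where
        term : ∀ i → i ≤ n → f' i ℤ.* g' (n ∸ i) ≡ 0ℤ
        term i i≤n with ℕP.≤-<-connex s i
        ... | inj₂ i<s = trans (cong (ℤ._* g' (n ∸ i)) (fz i i<s)) (ℤP.*-zeroˡ (g' (n ∸ i)))
        ... | inj₁ s≤i = trans (cong (f' i ℤ.*_) (gz (n ∸ i) n-i<t)) (ℤP.*-zeroʳ (f' i))
          where
            n-i<t : n ∸ i < t
            n-i<t = ℕP.+-cancelʳ-< i (n ∸ i) t (subst (_< t + i) (sym (ℕP.m∸n+n≡m i≤n))
                      (ℕP.<-≤-trans n<s+t (subst (s + t ≤_) (ℕP.+-comm i t) (ℕP.+-monoˡ-≤ t s≤i))))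
    shifted : ∀ m → (f' ⊛ g') (s + t + m) ≡ (f ⊛ g) m
    shifted m = begin
        (f' ⊛ g') (s + t + m)
      ≡⟨ cong (f' ⊛ g') (ℕP.+-assoc s t m) ⟩
        sumTo (λ i → f' i ℤ.* g' (s + (t + m) ∸ i)) (s + (t + m))
      ≡⟨ sumTo-dropZeros s (t + m) (λ i i<s →
           trans (cong (ℤ._* g' (s + (t + m) ∸ i)) (fz i i<s)) (ℤP.*-zeroˡ (g' (s + (t + m) ∸ i)))) ⟩
        sumTo (λ i → f' (s + i) ℤ.* g' (s + (t + m) ∸ (s + i))) (t + m)
      ≡⟨ sumTo-cong (t + m) (λ i _ →
           cong₂ ℤ._*_ (fe i) (cong g' (ℕP.[m+n]∸[m+o]≡n∸o s (t + m) i))) ⟩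
        sumTo (λ i → f i ℤ.* g' (t + m ∸ i)) (t + m)
      ≡⟨ sumTo-pad m (t + m) (ℕP.m≤n+m m t) (λ i m<i i≤t+m →
           trans (cong (f i ℤ.*_) (gz _ (t+m-i<t m<i i≤t+m))) (ℤP.*-zeroʳ (f i))) ⟩
        sumTo (λ i → f i ℤ.* g' (t + m ∸ i)) m
      ≡⟨ sumTo-cong m (λ i i≤m →
           cong (f i ℤ.*_) (trans (cong g' (ℕP.+-∸-assoc t i≤m)) (ge (m ∸ i)))) ⟩
        (f ⊛ g) m
      ∎
      where
        t+m-i<t : ∀ {i} → m < i → i ≤ t + m → t + m ∸ i < t
        t+m-i<t {i} m<i i≤t+m = ℕP.+-cancelʳ-< i _ t
          (subst (_< t + i) (sym (ℕP.m∸n+n≡m i≤t+m)) (ℕP.+-monoʳ-< t m<i))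

shift-oneS : Shift oneS oneS 0
shift-oneS = (λ _ ()) , (λ _ → refl)

shift-spow : ∀ {f' f c} → Shift f' f c → ∀ d → Shift (spow f' d) (spow f d) (d * c)
shift-spow h zero    = shift-oneS
shift-spow h (suc d) = shift-⊛ h (shift-spow h d)

shift-prod : ∀ {F' F a} → (∀ l → Shift (F' l) (F l) (a l)) →
             ∀ N → Shift (prodTo F' N) (prodTo F N) (natSum a N)
shift-prod h zero    = h zero
shift-prod h (suc N) = shift-⊛ (h (suc N)) (shift-prod h N)

-- In y = 1/x:  (1 + x^c)^{-1} = y^c (1 + y^c)^{-1},
-- i.e. Σ_j (-1)^j y^{c(j+1)} is the c-fold shift of Σ_j (-1)^j y^{cj}.
shift-invOnePlusX : ∀ c → 1 ≤ c → Shift (invOnePlusXinY c) (invOnePlusX c) c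
shift-invOnePlusX c c≥1 = low , shifted
  where
    open ≡-Reasoning
    c≤c[1+j] : ∀ j → c ≤ c * suc j
    c≤c[1+j] j = subst (c ≤_) (sym (ℕP.*-suc c j)) (ℕP.m≤m+n c (c * j))
    low : ∀ i → i < c → invOnePlusXinY c i ≡ 0ℤ
    low i i<c = sumTo-zero i (λ j _ → trans
      (cong (ℤ._* negOnePow j) (ind-no _ _ (λ e → ℕP.<⇒≱ i<c (subst (c ≤_) e (c≤c[1+j] j)))))
      (ℤP.*-zeroˡ (negOnePow j)))
    shifted : ∀ m → invOnePlusXinY c (c + m) ≡ invOnePlusX c m
    shifted m = begin
        sumTo (λ j → ind (c * suc j) (c + m) ℤ.* negOnePow j) (c + m)
      ≡⟨ sumTo-cong (c + m) (λ j _ → cong (ℤ._* negOnePow j) (ind-iff _ _ _ _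
           (λ e → ℕP.+-cancelˡ-≡ c _ _ (trans (sym (ℕP.*-suc c j)) e))
           (λ e → trans (ℕP.*-suc c j) (cong (_+_ c) e)))) ⟩
        sumTo (λ j → ind (c * j) m ℤ.* negOnePow j) (c + m)
      ≡⟨ sumTo-pad m (c + m) (ℕP.m≤n+m m c) (λ j m<j _ → trans
           (cong (ℤ._* negOnePow j) (ind-no _ _ (λ e → ℕP.<⇒≱ m<j (subst (j ≤_) e (j≤cj j)))))
           (ℤP.*-zeroˡ (negOnePow j))) ⟩
        invOnePlusX c m
      ∎
      where
        j≤cj : ∀ j → j ≤ c * j
        j≤cj j = subst (_≤ c * j) (ℕP.*-identityˡ j) (ℕP.*-monoˡ-≤ j c≥1)

-- Base-b digit expansion

module Digits (b : ℕ) .{{_ : NonZero b}} where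

  quot : ℕ → ℕ → ℕ
  quot zero    m = m
  quot (suc l) m = quot l (m / b)

  quot-suc : ∀ l m → quot (suc l) m ≡ quot l m / b
  quot-suc zero    m = refl
  quot-suc (suc l) m = quot-suc l (m / b)

  digit-quot : ∀ l m → digit b l m ≡ quot l m % b
  digit-quot zero    m = refl
  digit-quot (suc l) m = digit-quot l (m / b)

  quot-split : ∀ l m → b ^ l * quot l m ≡ digit b l m * b ^ l + b ^ suc l * quot (suc l) m
  quot-split l m = begin
      b ^ l * quot l m
    ≡⟨ cong (b ^ l *_) (m≡m%n+[m/n]*n (quot l m) b) ⟩
      b ^ l * (quot l m % b + quot l m / b * b)
    ≡⟨ distribute (b ^ l) (quot l m % b) (quot l m / b) b ⟩
      quot l m % b * b ^ l + b * b ^ l * (quot l m / b)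
    ≡⟨ sym (cong₂ (λ d r → d * b ^ l + b * b ^ l * r) (digit-quot l m) (quot-suc l m)) ⟩
      digit b l m * b ^ l + b ^ suc l * quot (suc l) m
    ∎
    where
      open ≡-Reasoning
      distribute : ∀ x r s y → x * (r + s * y) ≡ r * x + y * x * s
      distribute = ℕSolver.solve-∀

  digit-expansion : ∀ N m → natSum (λ l → digit b l m * b ^ l) N + b ^ suc N * quot (suc N) m ≡ m
  digit-expansion zero    m = trans (sym (quot-split 0 m)) (ℕP.*-identityˡ m)
  digit-expansion (suc N) m = begin
      a (suc N) + natSum a N + b ^ suc (suc N) * quot (suc (suc N)) m
    ≡⟨ swap (a (suc N)) (natSum a N) _ ⟩
      natSum a N + (a (suc N) + b ^ suc (suc N) * quot (suc (suc N)) m)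
    ≡⟨ cong (_+_ (natSum a N)) (sym (quot-split (suc N) m)) ⟩
      natSum a N + b ^ suc N * quot (suc N) m
    ≡⟨ digit-expansion N m ⟩
      m
    ∎
    where
      open ≡-Reasoning
      a : ℕ → ℕ
      a l = digit b l m * b ^ l
      swap : ∀ x y z → x + y + z ≡ y + (x + z)
      swap = ℕSolver.solve-∀

  -- needed to see that digits beyond position m vanish
  n<b^n : 1 < b → ∀ n → n < b ^ n
  n<b^n b>1 zero    = s≤s z≤n
  n<b^n b>1 (suc n) = ℕP.≤-<-trans (n<b^n b>1 n) (ℕP.^-monoʳ-< b b>1 (ℕP.n<1+n n))

  -- The digits of m, weighted by powers of b, sum to m (digits beyond
  -- position m vanish since m < b^{m+1}).
  digit-sum : 1 < b → ∀ m → natSum (λ l → digit b l m * b ^ l) m ≡ m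
  digit-sum b>1 m with quot (suc m) m | digit-expansion m m
  ... | zero  | expansion =
    trans (sym (trans (cong (_+_ _) (ℕP.*-zeroʳ (b ^ suc m))) (ℕP.+-identityʳ _))) expansion
  ... | suc k | expansion = ⊥-elim (ℕP.<⇒≱ m<b^[1+m] b^[1+m]≤m)
    where
      m<b^[1+m] : m < b ^ suc m
      m<b^[1+m] = ℕP.<-trans (n<b^n b>1 m) (ℕP.^-monoʳ-< b b>1 (ℕP.n<1+n m))
      b^[1+m]≤m : b ^ suc m ≤ m
      b^[1+m]≤m = ℕP.≤-trans (ℕP.m≤m*n (b ^ suc m) (suc k))
                    (ℕP.≤-trans (ℕP.m≤n+m _ _) (ℕP.≤-reflexive expansion))

neg-sub-pos : ∀ m k → -[1+ m ] - + k ≡ -[1+ (m + k) ]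
neg-sub-pos m zero    = cong -[1+_] (sym (ℕP.+-identityʳ m))
neg-sub-pos m (suc k) = cong -[1+_] (sym (ℕP.+-suc m k))

neg-gap : ∀ {k m} → k < m → k ⊖ m ≡ -[1+ (m ∸ suc k) ]
neg-gap {k} {m} k<m = trans (ℤP.⊖-< k<m) (cong (λ z → ℤ.- (+ z)) (ℕP.+-∸-assoc 1 k<m))

module _ (b : ℕ) .{{_ : NonZero b}} (b>1 : 1 < b) where
  open Digits b

  -- f_{m,b} is a palindrome of degree Σ_l m_l b^l = m.
  fPos-pal : ∀ m → Pal (fPos b m) m
  fPos-pal m = subst (Pal (fPos b m)) (digit-sum b>1 m)
    (pal-prod (λ l → pal-spow (pal-onePlusX (b ^ l)) (digit b l m)) m)

  fNeg-shift : ∀ M → Shift (fNegY b M) (fNegX b M) M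
  fNeg-shift M = subst (Shift (fNegY b M) (fNegX b M)) (digit-sum b>1 M)
    (shift-prod (λ l → shift-spow (shift-invOnePlusX (b ^ l) (ℕP.m^n>0 b l)) (digit b l M)) M)

  binomB-nonneg : ∀ m j → binomB b (+ m) j ≡ ext (fPos b m) j
  binomB-nonneg m (+ k)    = refl
  binomB-nonneg m -[1+ k ] = refl

  symmetry-nonneg : ∀ m j → binomB b (+ m) j ≡ binomB b (+ m) (+ m - j)
  symmetry-nonneg m j = begin
      binomB b (+ m) j             ≡⟨ binomB-nonneg m j ⟩
      ext (fPos b m) j             ≡⟨ sym (fPos-pal m j) ⟩
      ext (fPos b m) (+ m - j)     ≡⟨ sym (binomB-nonneg m (+ m - j)) ⟩
      binomB b (+ m) (+ m - j)     ∎
    where open ≡-Reasoning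

  -- For n = -(m'+1): coefficients at k ≥ 0 come from X, at k < 0 from Y;
  -- the reflection k ↦ n - k matches X with Y shifted by m'+1, and pairs
  -- up coefficients of Y below y^{m'+1}, which vanish.
  symmetry-neg : ∀ m' j → binomB b -[1+ m' ] j ≡ binomB b -[1+ m' ] (-[1+ m' ] - j)
  symmetry-neg m' (+ k) =
    sym (trans (cong (binomB b -[1+ m' ]) (neg-sub-pos m' k)) (shifted k))
    where
      shifted : ∀ i → fNegY b (suc m') (suc m' + i) ≡ fNegX b (suc m') i
      shifted = proj₂ (fNeg-shift (suc m'))
  symmetry-neg m' -[1+ k ] with ℕP.≤-<-connex m' k
  ... | inj₁ m'≤k = begin
      fNegY b (suc m') (suc k)
    ≡⟨ cong (λ z → fNegY b (suc m') (suc z)) (sym (ℕP.m+[n∸m]≡n m'≤k)) ⟩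
      fNegY b (suc m') (suc m' + (k ∸ m'))
    ≡⟨ shifted (k ∸ m') ⟩
      binomB b -[1+ m' ] (+ (k ∸ m'))
    ≡⟨ cong (binomB b -[1+ m' ]) (sym (trans (ℤP.[1+m]⊖[1+n]≡m⊖n k m') (ℤP.⊖-≥ m'≤k))) ⟩
      binomB b -[1+ m' ] (-[1+ m' ] - -[1+ k ])
    ∎
    where
      open ≡-Reasoning
      shifted : ∀ i → fNegY b (suc m') (suc m' + i) ≡ fNegX b (suc m') i
      shifted = proj₂ (fNeg-shift (suc m'))
  ... | inj₂ k<m' = begin
      fNegY b (suc m') (suc k)
    ≡⟨ low (suc k) (s≤s k<m') ⟩
      0ℤ
    ≡⟨ sym (low _ (s≤s (ℕP.∸-monoʳ-< {m'} {suc k} {0} (s≤s z≤n) k<m'))) ⟩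
      binomB b -[1+ m' ] -[1+ (m' ∸ suc k) ]
    ≡⟨ cong (binomB b -[1+ m' ]) (sym (trans (ℤP.[1+m]⊖[1+n]≡m⊖n k m') (neg-gap k<m'))) ⟩
      binomB b -[1+ m' ] (-[1+ m' ] - -[1+ k ])
    ∎
    where
      open ≡-Reasoning
      low : ∀ i → i < suc m' → fNegY b (suc m') i ≡ 0ℤ
      low = proj₁ (fNeg-shift (suc m'))

mainTheorem2 : (b : ℕ) → .{{_ : NonZero b}} → 2 ≤ b →
                 (n k : ℤ) → binomB b n k ≡ binomB b n (n - k)
mainTheorem2 b b>1 (+ m)      k = symmetry-nonneg b b>1 m k
mainTheorem2 b b>1 -[1+ m' ] k = symmetry-neg b b>1 m' k
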